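{- Let $t$ be a $\lambda$-term typable in system $\mathcal D$. Then $t$ is strongly normalizing for the reduction generated by the union of the rules $\beta$, $\delta$, $\gamma$ and $assoc$.
   Context: $\lambda$-terms: $\mathcal M ::= x \mid \lambda x.\mathcal M \mid (\mathcal M\ \mathcal M)$, application associating to the left; terms up to renaming of bound variables. Rules (applicable to any subterm): $\beta$: $(\lambda x.M\ N) \triangleright M[x:=N]$; $\delta$: $(\lambda y.\lambda x.M\ N) \triangleright \lambda x.(\lambda y.M\ N)$ ($x$ not free in $N$); $\gamma$: $(\lambda x.M\ N\ P) \triangleright (\lambda x.(M\ P)\ N)$ ($x$ not free in $P$); $assoc$: $(M\ (\lambda x.N\ P)) \triangleright (\lambda x.(M\ N)\ P)$ ($x$ not free in $M$). Strongly normalizing means every reduction sequence is finite. System $\mathcal D$: with a set $\mathcal A$ of atomic types, simple types $\mathcal S ::= \mathcal A \mid \mathcal T \to \mathcal S$ and types $\mathcal T ::= \mathcal S \mid \mathcal S \wedge \mathcal T$; contexts $\Gamma$ are sets of declarations $x:A$; rules: $\Gamma, x:A \vdash x:A$; from $\Gamma \vdash M : A\to B$ and $\Gamma \vdash N:A$ infer $\Gamma \vdash (M\ N):B$; from $\Gamma, x:A \vdash M:B$ infer $\Gamma \vdash \lambda x.M : A \to B$; from $\Gamma \vdash M : A\wedge B$ infer $\Gamma \vdash M:A$ and $\Gamma \vdash M : B$; from $\Gamma \vdash M:A$ and $\Gamma \vdash M:B$ infer $\Gamma \vdash M : A \wedge B$. A term $t$ is typable if $\Gamma \vdash t : A$ for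 some context $\Gamma$ and type $A$. -}

module Defs where

open import Data.Nat using (ℕ; zero; suc)
open import Data.List using (List; []; _∷_)
open import Data.Product using (Σ; ∃; _,_)
open import Induction.WellFounded using (Acc)

-- λ-terms up to α-conversion: de Bruijn indices

data Tm : Set where
  var : ℕ → Tm
  lam : Tm → Tm
  app : Tm → Tm → Tm

ext : (ℕ → ℕ) → ℕ → ℕ
ext ρ zero    = zero
ext ρ (suc n) = suc (ρ n)

rename : (ℕ → ℕ) → Tm → Tm
rename ρ (var n)   = var (ρ n)
rename ρ (lam M)   = lam (rename (ext ρ) M)
rename ρ (app M N) = app (rename ρ M) (rename ρ N)

shift : Tm → Tm
shift = rename suc

swap01 : ℕ → ℕ
swap01 zero          = suc zero
swap01 (suc zero)    = zero
swap01 (suc (suc n)) = suc (suc n)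

exts : (ℕ → Tm) → ℕ → Tm
exts σ zero    = var zero
exts σ (suc n) = shift (σ n)

subst : (ℕ → Tm) → Tm → Tm
subst σ (var n)   = σ n
subst σ (lam M)   = lam (subst (exts σ) M)
subst σ (app M N) = app (subst σ M) (subst σ N)

-- M[0 := N], the remaining free variables are decremented
subst0 : Tm → ℕ → Tm
subst0 N zero    = N
subst0 N (suc n) = var n

_[_] : Tm → Tm → Tm
M [ N ] = subst (subst0 N) M

-- Head rules β, δ, γ, assoc (side conditions "x not free in ..." are
-- realised by shifting, as the bound variable is fresh)

data _▷_ : Tm → Tm → Set where
  -- (λx.M N) ▷ M[x:=N]
  β     : ∀ M N → app (lam M) N ▷ (M [ N ])
  -- (λy.λx.M N) ▷ λx.(λy.M N)
  δ     : ∀ M N → app (lam (lam M)) N ▷ lam (app (lam (rename swap01 M)) (shift N))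
  -- (λx.M N P) ▷ (λx.(M P) N)
  γ     : ∀ M N P → app (app (lam M) N) P ▷ app (lam (app M (shift P))) N
  -- (M (λx.N P)) ▷ (λx.(M N) P)
  assoc : ∀ M N P → app M (app (lam N) P) ▷ app (lam (app (shift M) N)) P

data _⟶_ : Tm → Tm → Set where
  top  : ∀ {M N} → M ▷ N → M ⟶ N
  ξlam : ∀ {M M'} → M ⟶ M' → lam M ⟶ lam M'
  ξapl : ∀ {M M' N} → M ⟶ M' → app M N ⟶ app M' N
  ξapr : ∀ {M N N'} → N ⟶ N' → app M N ⟶ app M N'

-- strong normalisation: accessibility for the reduction relation
-- (no infinite reduction sequence starting from t)
SN : Tm → Set
SN t = Acc (λ u v → v ⟶ u) t

module SystemD (Atom : Set) where

  mutual
    data SType : Set where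
      atom : Atom → SType
      _⇒_  : Ty → SType → SType

    data Ty : Set where
      simple : SType → Ty
      _∧_    : SType → Ty → Ty

  Ctx : Set
  Ctx = List Ty

  data _∋_⦂_ : Ctx → ℕ → Ty → Set where
    here  : ∀ {Γ A} → (A ∷ Γ) ∋ zero ⦂ A
    there : ∀ {Γ A B n} → Γ ∋ n ⦂ A → (B ∷ Γ) ∋ suc n ⦂ A

  data _⊢_⦂_ : Ctx → Tm → Ty → Set where
    ax   : ∀ {Γ n A} → Γ ∋ n ⦂ A → Γ ⊢ var n ⦂ A
    →E   : ∀ {Γ M N A B} → Γ ⊢ M ⦂ simple (A ⇒ B) → Γ ⊢ N ⦂ A → Γ ⊢ app M N ⦂ simple B
    →I   : ∀ {Γ M A B} → (A ∷ Γ) ⊢ M ⦂ simple B → Γ ⊢ lam M ⦂ simple (A ⇒ B)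
    ∧E₁  : ∀ {Γ M A B} → Γ ⊢ M ⦂ (A ∧ B) → Γ ⊢ M ⦂ simple A
    ∧E₂  : ∀ {Γ M A B} → Γ ⊢ M ⦂ (A ∧ B) → Γ ⊢ M ⦂ B
    ∧I   : ∀ {Γ M A B} → Γ ⊢ M ⦂ simple A → Γ ⊢ M ⦂ B → Γ ⊢ M ⦂ (A ∧ B)

  Typable : Tm → Set
  Typable t = Σ Ctx λ Γ → Σ Ty λ A → Γ ⊢ t ⦂ A

module Submission where

-- Types are interpreted as sets of terms (atoms as SN, arrows by
-- application, ∧ as intersection); the fundamental lemma `adequacy` shows
-- every typed term reducible, and reducible terms are SN.  The only
-- non-standard ingredients are the two closure properties of SN needed for
-- the arrow and atom cases, which must cope with the permutative rules:
--  * head expansion: SN N and SN (M[N] P₁…Pₙ) imply SN ((λM) N P₁…Pₙ).  As δ,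
--    γ and assoc move redexes across binders and arguments, this is proved
--    for a redex in an arbitrary spine of abstractions and applications
--    (`expansion`), after classifying the steps out of such a term
--    (`redexStep`); the induction runs on N for "reduces to or is a subterm
--    of" (`_≺_`), on the contractum, on the number of spine arguments and on
--    the size of the body.
--  * neutral terms x P₁…Pₙ with SN arguments are SN (`neutral-SN`); here an
--    assoc step on an argument is handled by head expansion.

open import Defs
open import Data.Nat using (ℕ; zero; suc; _+_; _<_)
open import Data.Nat.Properties using (+-suc; +-comm; ≤-refl)
open import Data.Nat.Induction using (<-wellFounded)
open import Data.Product using (Σ; _,_; _×_; proj₁; proj₂)
open import Data.Sum using (_⊎_; inj₁; inj₂)
open import Data.List using (List; []; _∷_; _++_)
open import Data.List.Relation.Unary.All using (All; []; _∷_)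
open import Induction.WellFounded using (Acc; acc)
open import Relation.Binary.Construct.Closure.ReflexiveTransitive using (Star; ε; _◅_; _◅◅_; gmap)
open import Relation.Binary.PropositionalEquality
  using (_≡_; _≗_; refl; sym; trans; cong; cong₂; module ≡-Reasoning)
  renaming (subst to transport)

ext-cong : ∀ {ρ ρ'} → ρ ≗ ρ' → ext ρ ≗ ext ρ'
ext-cong h zero    = refl
ext-cong h (suc n) = cong suc (h n)

rename-cong : ∀ {ρ ρ'} → ρ ≗ ρ' → rename ρ ≗ rename ρ'
rename-cong h (var n)   = cong var (h n)
rename-cong h (lam M)   = cong lam (rename-cong (ext-cong h) M)
rename-cong h (app M N) = cong₂ app (rename-cong h M) (rename-cong h N)

exts-cong : ∀ {σ τ} → σ ≗ τ → exts σ ≗ exts τ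
exts-cong h zero    = refl
exts-cong h (suc n) = cong shift (h n)

subst-cong : ∀ {σ τ} → σ ≗ τ → subst σ ≗ subst τ
subst-cong h (var n)   = h n
subst-cong h (lam M)   = cong lam (subst-cong (exts-cong h) M)
subst-cong h (app M N) = cong₂ app (subst-cong h M) (subst-cong h N)

rename-id : ∀ {ρ} → ρ ≗ (λ n → n) → ∀ M → rename ρ M ≡ M
rename-id h (var n)   = cong var (h n)
rename-id h (lam M)   = cong lam (rename-id (ext-id h) M)
  where
  ext-id : ∀ {ρ} → ρ ≗ (λ n → n) → ext ρ ≗ (λ n → n)
  ext-id h zero    = refl
  ext-id h (suc n) = cong suc (h n)
rename-id h (app M N) = cong₂ app (rename-id h M) (rename-id h N)

rename-∘ : ∀ ρ ρ' M → rename ρ (rename ρ' M) ≡ rename (λ n → ρ (ρ' n)) M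
rename-∘ ρ ρ' (var n)   = refl
rename-∘ ρ ρ' (lam M)   =
  cong lam (trans (rename-∘ (ext ρ) (ext ρ') M) (rename-cong ext-∘ M))
  where
  ext-∘ : (λ n → ext ρ (ext ρ' n)) ≗ ext (λ n → ρ (ρ' n))
  ext-∘ zero    = refl
  ext-∘ (suc n) = refl
rename-∘ ρ ρ' (app M N) = cong₂ app (rename-∘ ρ ρ' M) (rename-∘ ρ ρ' N)

rename-as-subst : ∀ ρ M → rename ρ M ≡ subst (λ n → var (ρ n)) M
rename-as-subst ρ (var n)   = refl
rename-as-subst ρ (lam M)   =
  cong lam (trans (rename-as-subst (ext ρ) M) (subst-cong exts-var M))
  where
  exts-var : (λ n → var (ext ρ n)) ≗ exts (λ n → var (ρ n))
  exts-var zero    = refl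
  exts-var (suc n) = refl
rename-as-subst ρ (app M N) = cong₂ app (rename-as-subst ρ M) (rename-as-subst ρ N)

subst-rename : ∀ σ ρ M → subst σ (rename ρ M) ≡ subst (λ n → σ (ρ n)) M
subst-rename σ ρ (var n)   = refl
subst-rename σ ρ (lam M)   =
  cong lam (trans (subst-rename (exts σ) (ext ρ) M) (subst-cong exts-ext M))
  where
  exts-ext : (λ n → exts σ (ext ρ n)) ≗ exts (λ n → σ (ρ n))
  exts-ext zero    = refl
  exts-ext (suc n) = refl
subst-rename σ ρ (app M N) = cong₂ app (subst-rename σ ρ M) (subst-rename σ ρ N)

rename-subst : ∀ ρ σ M → rename ρ (subst σ M) ≡ subst (λ n → rename ρ (σ n)) M
rename-subst ρ σ (var n)   = refl
rename-subst ρ σ (lam M)   =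
  cong lam (trans (rename-subst (ext ρ) (exts σ) M) (subst-cong ext-exts M))
  where
  ext-exts : (λ n → rename (ext ρ) (exts σ n)) ≗ exts (λ n → rename ρ (σ n))
  ext-exts zero    = refl
  ext-exts (suc n) = trans (rename-∘ (ext ρ) suc (σ n)) (sym (rename-∘ suc ρ (σ n)))
rename-subst ρ σ (app M N) = cong₂ app (rename-subst ρ σ M) (rename-subst ρ σ N)

subst-∘ : ∀ σ τ M → subst σ (subst τ M) ≡ subst (λ n → subst σ (τ n)) M
subst-∘ σ τ (var n)   = refl
subst-∘ σ τ (lam M)   =
  cong lam (trans (subst-∘ (exts σ) (exts τ) M) (subst-cong exts-exts M))
  where
  exts-exts : (λ n → subst (exts σ) (exts τ n)) ≗ exts (λ n → subst σ (τ n))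
  exts-exts zero    = refl
  exts-exts (suc n) = trans (subst-rename (exts σ) suc (τ n)) (sym (rename-subst suc σ (τ n)))
subst-∘ σ τ (app M N) = cong₂ app (subst-∘ σ τ M) (subst-∘ σ τ N)

subst-id : ∀ {σ} → σ ≗ var → ∀ M → subst σ M ≡ M
subst-id h M =
  trans (subst-cong h M) (trans (sym (rename-as-subst (λ n → n) M)) (rename-id (λ _ → refl) M))

shift-[] : ∀ N M → shift M [ N ] ≡ M
shift-[] N M = trans (subst-rename (subst0 N) suc M) (subst-id (λ _ → refl) M)

subst-[] : ∀ σ M N → subst σ (M [ N ]) ≡ subst (exts σ) M [ subst σ N ]
subst-[] σ M N = begin
  subst σ (M [ N ])                                   ≡⟨ subst-∘ σ (subst0 N) M ⟩
  subst (λ n → subst σ (subst0 N n)) M                ≡⟨ subst-cong pointwise M ⟩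
  subst (λ n → subst (subst0 (subst σ N)) (exts σ n)) M ≡⟨ sym (subst-∘ (subst0 (subst σ N)) (exts σ) M) ⟩
  subst (exts σ) M [ subst σ N ]                      ∎
  where
  open ≡-Reasoning
  pointwise : (λ n → subst σ (subst0 N n)) ≗ (λ n → subst (subst0 (subst σ N)) (exts σ n))
  pointwise zero    = refl
  pointwise (suc n) = sym (shift-[] (subst σ N) (σ n))

rename-[] : ∀ ρ M N → rename ρ (M [ N ]) ≡ rename (ext ρ) M [ rename ρ N ]
rename-[] ρ M N = begin
  rename ρ (M [ N ])                                  ≡⟨ rename-as-subst ρ (M [ N ]) ⟩
  subst (λ n → var (ρ n)) (M [ N ])                   ≡⟨ subst-[] _ M N ⟩
  subst (exts (λ n → var (ρ n))) M [ subst _ N ]      ≡⟨ cong₂ _[_] (sym (trans (rename-as-subst (ext ρ) M) (subst-cong var-ext M)))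
                                                                    (sym (rename-as-subst ρ N)) ⟩
  rename (ext ρ) M [ rename ρ N ]                     ∎
  where
  open ≡-Reasoning
  var-ext : (λ n → var (ext ρ n)) ≗ exts (λ n → var (ρ n))
  var-ext zero    = refl
  var-ext (suc n) = refl

_·_ : Tm → (ℕ → Tm) → ℕ → Tm
(u · σ) zero    = u
(u · σ) (suc n) = σ n

exts-[] : ∀ u σ M → subst (exts σ) M [ u ] ≡ subst (u · σ) M
exts-[] u σ M = trans (subst-∘ (subst0 u) (exts σ) M) (subst-cong pointwise M)
  where
  pointwise : (λ n → subst (subst0 u) (exts σ n)) ≗ (u · σ)
  pointwise zero    = refl
  pointwise (suc n) = shift-[] u (σ n)

subst-shift : ∀ σ P → subst (exts σ) (shift P) ≡ shift (subst σ P)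
subst-shift σ P = trans (subst-rename (exts σ) suc P) (sym (rename-subst suc σ P))

rename-shift : ∀ ρ P → rename (ext ρ) (shift P) ≡ shift (rename ρ P)
rename-shift ρ P = trans (rename-∘ (ext ρ) suc P) (sym (rename-∘ suc ρ P))

subst-swap : ∀ σ M → subst (exts (exts σ)) (rename swap01 M) ≡ rename swap01 (subst (exts (exts σ)) M)
subst-swap σ M =
  trans (subst-rename _ swap01 M) (trans (subst-cong pointwise M) (sym (rename-subst swap01 _ M)))
  where
  pointwise : (λ n → exts (exts σ) (swap01 n)) ≗ (λ n → rename swap01 (exts (exts σ) n))
  pointwise zero          = refl
  pointwise (suc zero)    = refl
  pointwise (suc (suc n)) =
    sym (trans (rename-∘ swap01 suc (shift (σ n))) (trans (rename-∘ _ suc (σ n)) (sym (rename-∘ suc suc (σ n)))))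

rename-swap : ∀ ρ M → rename (ext (ext ρ)) (rename swap01 M) ≡ rename swap01 (rename (ext (ext ρ)) M)
rename-swap ρ M =
  trans (rename-∘ _ swap01 M) (trans (rename-cong pointwise M) (sym (rename-∘ swap01 _ M)))
  where
  pointwise : (λ n → ext (ext ρ) (swap01 n)) ≗ (λ n → swap01 (ext (ext ρ) n))
  pointwise zero          = refl
  pointwise (suc zero)    = refl
  pointwise (suc (suc n)) = refl

swap-[] : ∀ N M → rename swap01 M [ shift N ] ≡ subst (exts (subst0 N)) M
swap-[] N M = trans (subst-rename _ swap01 M) (subst-cong pointwise M)
  where
  pointwise : (λ n → subst0 (shift N) (swap01 n)) ≗ exts (subst0 N)
  pointwise zero          = refl
  pointwise (suc zero)    = refl
  pointwise (suc (suc n)) = refl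

_⟶⟨_⟩ : ∀ {M A B} → M ⟶ A → A ≡ B → M ⟶ B
s ⟶⟨ refl ⟩ = s

≡-⟶ : ∀ {A B C} → A ≡ B → B ⟶ C → A ⟶ C
≡-⟶ refl s = s

subst-⟶ : ∀ σ {M M'} → M ⟶ M' → subst σ M ⟶ subst σ M'
subst-⟶ σ (top (β M N))       = top (β _ _) ⟶⟨ sym (subst-[] σ M N) ⟩
subst-⟶ σ (top (δ M N))       =
  top (δ _ _) ⟶⟨ cong lam (cong₂ app (cong lam (sym (subst-swap σ M))) (sym (subst-shift σ N))) ⟩
subst-⟶ σ (top (γ M N P))     = top (γ _ _ _) ⟶⟨ cong (λ X → app (lam (app _ X)) _) (sym (subst-shift σ P)) ⟩
subst-⟶ σ (top (assoc M N P)) = top (assoc _ _ _) ⟶⟨ cong (λ X → app (lam (app X _)) _) (sym (subst-shift σ M)) ⟩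
subst-⟶ σ (ξlam s)            = ξlam (subst-⟶ (exts σ) s)
subst-⟶ σ (ξapl s)            = ξapl (subst-⟶ σ s)
subst-⟶ σ (ξapr s)            = ξapr (subst-⟶ σ s)

rename-⟶ : ∀ ρ {M M'} → M ⟶ M' → rename ρ M ⟶ rename ρ M'
rename-⟶ ρ {M} {M'} s rewrite rename-as-subst ρ M | rename-as-subst ρ M' = subst-⟶ _ s

-- Conversely every step out of a renamed term is the renaming of a step:
-- renaming neither creates nor destroys redexes.

record ReflectedStep (ρ : ℕ → ℕ) (A B : Tm) : Set where
  constructor reflected
  field
    {A'}    : Tm
    step    : A ⟶ A'
    renamed : B ≡ rename ρ A'

reflect-▷ : ∀ ρ {X B} → X ▷ B → ∀ A → rename ρ A ≡ X → ReflectedStep ρ A B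
reflect-▷ ρ (β _ _) (app (lam M) N) refl = reflected (top (β M N)) (sym (rename-[] ρ M N))
reflect-▷ ρ (δ _ _) (app (lam (lam M)) N) refl =
  reflected (top (δ M N)) (cong lam (cong₂ app (cong lam (sym (rename-swap ρ M))) (sym (rename-shift ρ N))))
reflect-▷ ρ (γ _ _ _) (app (app (lam M) N) P) refl =
  reflected (top (γ M N P)) (cong (λ X → app (lam (app _ X)) _) (sym (rename-shift ρ P)))
reflect-▷ ρ (assoc _ _ _) (app M (app (lam N) P)) refl =
  reflected (top (assoc M N P)) (cong (λ X → app (lam (app X _)) _) (sym (rename-shift ρ M)))
reflect-▷ ρ (β _ _)       (var _)                     ()
reflect-▷ ρ (β _ _)       (lam _)                     ()
reflect-▷ ρ (β _ _)       (app (var _) _)             ()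
reflect-▷ ρ (β _ _)       (app (app _ _) _)           ()
reflect-▷ ρ (δ _ _)       (var _)                     ()
reflect-▷ ρ (δ _ _)       (lam _)                     ()
reflect-▷ ρ (δ _ _)       (app (var _) _)             ()
reflect-▷ ρ (δ _ _)       (app (app _ _) _)           ()
reflect-▷ ρ (δ _ _)       (app (lam (var _)) _)       ()
reflect-▷ ρ (δ _ _)       (app (lam (app _ _)) _)     ()
reflect-▷ ρ (γ _ _ _)     (var _)                     ()
reflect-▷ ρ (γ _ _ _)     (lam _)                     ()
reflect-▷ ρ (γ _ _ _)     (app (var _) _)             ()
reflect-▷ ρ (γ _ _ _)     (app (lam _) _)             ()
reflect-▷ ρ (γ _ _ _)     (app (app (var _) _) _)     ()
reflect-▷ ρ (γ _ _ _)     (app (app (app _ _) _) _)   ()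
reflect-▷ ρ (assoc _ _ _) (var _)                     ()
reflect-▷ ρ (assoc _ _ _) (lam _)                     ()
reflect-▷ ρ (assoc _ _ _) (app _ (var _))             ()
reflect-▷ ρ (assoc _ _ _) (app _ (lam _))             ()
reflect-▷ ρ (assoc _ _ _) (app _ (app (var _) _))     ()
reflect-▷ ρ (assoc _ _ _) (app _ (app (app _ _) _))   ()

reflect-⟶ : ∀ ρ A {B} → rename ρ A ⟶ B → ReflectedStep ρ A B
reflect-⟶ ρ (var n)   (top r) = reflect-▷ ρ r (var n) refl
reflect-⟶ ρ (lam A)   (top r) = reflect-▷ ρ r (lam A) refl
reflect-⟶ ρ (app A C) (top r) = reflect-▷ ρ r (app A C) refl
reflect-⟶ ρ (lam A) (ξlam s) with reflect-⟶ (ext ρ) A s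
... | reflected s' e = reflected (ξlam s') (cong lam e)
reflect-⟶ ρ (app A C) (ξapl s) with reflect-⟶ ρ A s
... | reflected s' e = reflected (ξapl s') (cong₂ app e refl)
reflect-⟶ ρ (app A C) (ξapr s) with reflect-⟶ ρ C s
... | reflected s' e = reflected (ξapr s') (cong₂ app refl e)

infix 4 _⟶*_
_⟶*_ : Tm → Tm → Set
_⟶*_ = Star _⟶_

app-⟶* : ∀ {M M' N N'} → M ⟶* M' → N ⟶* N' → app M N ⟶* app M' N'
app-⟶* p q = gmap (λ X → app X _) ξapl p ◅◅ gmap (app _) ξapr q

subst-⟶* : ∀ {σ τ} → (∀ n → σ n ⟶* τ n) → ∀ M → subst σ M ⟶* subst τ M
subst-⟶* h (var n)   = h n
subst-⟶* {σ} {τ} h (lam M) = gmap lam ξlam (subst-⟶* exts-⟶* M)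
  where
  exts-⟶* : ∀ n → exts σ n ⟶* exts τ n
  exts-⟶* zero    = ε
  exts-⟶* (suc n) = gmap shift (rename-⟶ suc) (h n)
subst-⟶* h (app M N) = app-⟶* (subst-⟶* h M) (subst-⟶* h N)

[]-⟶* : ∀ {N N'} → N ⟶ N' → ∀ M → M [ N ] ⟶* M [ N' ]
[]-⟶* {N} {N'} s = subst-⟶* subst0-⟶*
  where
  subst0-⟶* : ∀ n → subst0 N n ⟶* subst0 N' n
  subst0-⟶* zero    = s ◅ ε
  subst0-⟶* (suc n) = ε

SN-⟶* : ∀ {M N} → M ⟶* N → SN M → SN N
SN-⟶* ε       sn       = sn
SN-⟶* (s ◅ p) (acc sn) = SN-⟶* p (sn s)

SN-appˡ : ∀ {M N} → SN (app M N) → SN M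
SN-appˡ (acc sn) = acc λ s → SN-appˡ (sn (ξapl s))

SN-appʳ : ∀ {M N} → SN (app M N) → SN N
SN-appʳ (acc sn) = acc λ s → SN-appʳ (sn (ξapr s))

data _⊏_ : Tm → Tm → Set where
  funˢ : ∀ {M N} → M ⊏ app M N
  argˢ : ∀ {M N} → N ⊏ app M N
  bodyˢ : ∀ {M} → M ⊏ lam M

_≺_ : Tm → Tm → Set
u ≺ t = (t ⟶ u) ⊎ (u ⊏ t)

data _⊑_ : Tm → Tm → Set where
  here  : ∀ {t} → t ⊑ t
  inFun : ∀ {s M N} → s ⊑ M → s ⊑ app M N
  inArg : ∀ {s M N} → s ⊑ N → s ⊑ app M N
  inBody : ∀ {s M} → s ⊑ M → s ⊑ lam M

lift-⊑ : ∀ {s t s'} → s ⊑ t → s ⟶ s' → Σ Tm λ t' → (t ⟶ t') × (s' ⊑ t')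
lift-⊑ here s = _ , s , here
lift-⊑ (inFun p) s with lift-⊑ p s
... | _ , q , p' = _ , ξapl q , inFun p'
lift-⊑ (inArg p) s with lift-⊑ p s
... | _ , q , p' = _ , ξapr q , inArg p'
lift-⊑ (inBody p) s with lift-⊑ p s
... | _ , q , p' = _ , ξlam q , inBody p'

⊏-⊑ : ∀ {v s t} → v ⊏ s → s ⊑ t → v ⊑ t
⊏-⊑ funˢ  here       = inFun here
⊏-⊑ argˢ  here       = inArg here
⊏-⊑ bodyˢ here       = inBody here
⊏-⊑ sub   (inFun p)  = inFun (⊏-⊑ sub p)
⊏-⊑ sub   (inArg p)  = inArg (⊏-⊑ sub p)
⊏-⊑ sub   (inBody p) = inBody (⊏-⊑ sub p)

mutual
  subterm-acc : ∀ {t} → SN t → ∀ s → s ⊑ t → Acc _≺_ s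
  subterm-acc sn s p = acc (predecessor-acc sn s p)

  predecessor-acc : ∀ {t} → SN t → ∀ s → s ⊑ t → ∀ {v} → v ≺ s → Acc _≺_ v
  predecessor-acc (acc sn) s p (inj₁ step) =
    let _ , step' , p' = lift-⊑ p step in subterm-acc (sn step') _ p'
  predecessor-acc sn (app M N) p (inj₂ funˢ)  = subterm-acc sn M (⊏-⊑ funˢ p)
  predecessor-acc sn (app M N) p (inj₂ argˢ)  = subterm-acc sn N (⊏-⊑ argˢ p)
  predecessor-acc sn (lam M)   p (inj₂ bodyˢ) = subterm-acc sn M (⊏-⊑ bodyˢ p)

SN⇒Acc≺ : ∀ {t} → SN t → Acc _≺_ t
SN⇒Acc≺ sn = subterm-acc sn _ here

-- Spines: the contexts  λ…λ(… ([ ] P₁) … Pₙ)  built from abstractions and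
-- applications to arguments, indexed by the number k of binders above the
-- hole.  The expansion lemma is proved for redexes sitting in such a
-- context, since δ, γ and assoc move redexes across binders and arguments.

data Spine : ℕ → Set where
  hole : Spine 0
  lamˢ : ∀ {k} → Spine k → Spine (suc k)
  appˢ : ∀ {k} → Spine k → Tm → Spine k

plug : ∀ {k} → Spine k → Tm → Tm
plug hole       H = H
plug (lamˢ S)   H = lam (plug S H)
plug (appˢ S P) H = app (plug S H) P

#args : ∀ {k} → Spine k → ℕ
#args hole       = 0
#args (lamˢ S)   = #args S
#args (appˢ S P) = suc (#args S)

plug-⟶ : ∀ {k} (S : Spine k) {A B} → A ⟶ B → plug S A ⟶ plug S B
plug-⟶ hole       s = s
plug-⟶ (lamˢ S)   s = ξlam (plug-⟶ S s)
plug-⟶ (appˢ S P) s = ξapl (plug-⟶ S s)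

plug-⟶* : ∀ {k} (S : Spine k) {A B} → A ⟶* B → plug S A ⟶* plug S B
plug-⟶* S = gmap (plug S) (plug-⟶ S)

exts^ : ℕ → (ℕ → Tm) → ℕ → Tm
exts^ zero    σ = σ
exts^ (suc k) σ = exts^ k (exts σ)

substˢ : ∀ {k} → (ℕ → Tm) → Spine k → Spine k
substˢ σ hole       = hole
substˢ σ (lamˢ S)   = lamˢ (substˢ (exts σ) S)
substˢ σ (appˢ S P) = appˢ (substˢ σ S) (subst σ P)

subst-plug : ∀ {k} σ (S : Spine k) H → subst σ (plug S H) ≡ plug (substˢ σ S) (subst (exts^ k σ) H)
subst-plug σ hole       H = refl
subst-plug σ (lamˢ S)   H = cong lam (subst-plug (exts σ) S H)
subst-plug σ (appˢ S P) H = cong₂ app (subst-plug σ S H) refl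

lamᴴ : ∀ {k} → Spine k → Spine (suc k)
lamᴴ hole       = lamˢ hole
lamᴴ (lamˢ S)   = lamˢ (lamᴴ S)
lamᴴ (appˢ S P) = appˢ (lamᴴ S) P

plug-lamᴴ : ∀ {k} (S : Spine k) H → plug (lamᴴ S) H ≡ plug S (lam H)
plug-lamᴴ hole       H = refl
plug-lamᴴ (lamˢ S)   H = cong lam (plug-lamᴴ S H)
plug-lamᴴ (appˢ S P) H = cong₂ app (plug-lamᴴ S H) refl

#args-lamᴴ : ∀ {k} (S : Spine k) → #args (lamᴴ S) ≡ #args S
#args-lamᴴ hole       = refl
#args-lamᴴ (lamˢ S)   = #args-lamᴴ S
#args-lamᴴ (appˢ S P) = cong suc (#args-lamᴴ S)

-- A term N closed off outside a spine with k binders appears in the hole as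
-- its weakening  wk k N.

wk : ℕ → Tm → Tm
wk k = rename (k +_)

wk-zero : ∀ N → wk 0 N ≡ N
wk-zero = rename-id (λ _ → refl)

shift-wk : ∀ k N → shift (wk k N) ≡ wk (suc k) N
shift-wk k = rename-∘ suc (k +_)

-- τ is uniform from k to k* when it maps the variables k+i (those not bound
-- by the spine) to k*+i; such a τ leaves weakened outside terms outside.

Uniform : ℕ → ℕ → (ℕ → Tm) → Set
Uniform k k* τ = ∀ i → τ (k + i) ≡ var (k* + i)

subst-wk : ∀ {k k* τ} → Uniform k k* τ → ∀ N → subst τ (wk k N) ≡ wk k* N
subst-wk {k} {k*} {τ} u N =
  trans (subst-rename τ (k +_) N) (trans (subst-cong u N) (sym (rename-as-subst (k* +_) N)))

uniform-cong : ∀ {k₁ k₂ k₁* k₂* τ} → k₁ ≡ k₂ → k₁* ≡ k₂* → Uniform k₁ k₁* τ → Uniform k₂ k₂* τ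
uniform-cong refl refl u = u

uniform-exts^ : ∀ j {k k* τ} → Uniform k k* τ → Uniform (j + k) (j + k*) (exts^ j τ)
uniform-exts^ zero    u = u
uniform-exts^ (suc j) {k} {k*} {τ} u =
  uniform-cong {τ = exts^ j (exts τ)} (+-suc j k) (+-suc j k*)
    (uniform-exts^ j {suc k} {suc k*} {exts τ} (λ i → cong shift (u i)))

uniform-suc : ∀ {k k* τ} → Uniform k k* τ → Uniform (suc k) (suc k*) τ
uniform-suc {k} {k*} {τ} u i =
  trans (cong τ (sym (+-suc k i))) (trans (u (suc i)) (cong var (+-suc k* i)))

uniform-spine : ∀ k {j j' σ} → Uniform j j' σ → Uniform (j + k) (j' + k) (exts^ k σ)
uniform-spine k {j} {j'} {σ} u =
  uniform-cong {τ = exts^ k σ} (+-comm k j) (+-comm k j') (uniform-exts^ k u)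

-- Besides the steps
-- inside M or N and the rules fired at the redex itself, a γ-step may pull
-- the first spine argument P into the redex; every other step happens in the
-- spine and transports the redex along a uniform substitution τ.

data RedexStep {k} (S : Spine k) : Tm → Tm → Tm → Set where
  inBody   : ∀ {M N M'} → M ⟶ M' → RedexStep S M N (plug S (app (lam M') N))
  inArg    : ∀ {M N N'} → N ⟶ N' → RedexStep S M N (plug S (app (lam M) N'))
  contract : ∀ {M N} → RedexStep S M N (plug S (M [ N ]))
  δ-redex  : ∀ {M N} → RedexStep S (lam M) N (plug S (lam (app (lam (rename swap01 M)) (shift N))))
  assoc-redex : ∀ {M N₁ N₂} →
    RedexStep S M (app (lam N₁) N₂) (plug S (app (lam (app (shift (lam M)) N₁)) N₂))
  γ-spine  : ∀ {M N} (S₀ : Spine k) P → suc (#args S₀) ≡ #args S → (∀ X → plug S X ≡ plug S₀ (app X P)) →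
    RedexStep S M N (plug S₀ (app (lam (app M (shift P))) N))
  inSpine  : ∀ {M N k*} (S* : Spine k*) τ → Uniform k k* τ → (∀ H → plug S H ⟶ plug S* (subst τ H)) →
    RedexStep S M N (plug S* (subst τ (app (lam M) N)))

redexStep-≡ : ∀ {k} {S : Spine k} {M N u u'} → RedexStep S M N u → u ≡ u' → RedexStep S M N u'
redexStep-≡ r refl = r

redexStep-lamˢ : ∀ {k} {S : Spine k} {M N u} → RedexStep S M N u → RedexStep (lamˢ S) M N (lam u)
redexStep-lamˢ (inBody s)            = inBody s
redexStep-lamˢ (inArg s)             = inArg s
redexStep-lamˢ contract              = contract
redexStep-lamˢ δ-redex               = δ-redex
redexStep-lamˢ assoc-redex           = assoc-redex
redexStep-lamˢ (γ-spine S₀ P e h)    = γ-spine (lamˢ S₀) P e (λ X → cong lam (h X))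
redexStep-lamˢ (inSpine S* τ u h)    = inSpine (lamˢ S*) τ (uniform-suc {τ = τ} u) (λ H → ξlam (h H))

redexStep-appˢ : ∀ {k} {S : Spine k} {M N u} Q → RedexStep S M N u → RedexStep (appˢ S Q) M N (app u Q)
redexStep-appˢ Q (inBody s)          = inBody s
redexStep-appˢ Q (inArg s)           = inArg s
redexStep-appˢ Q contract            = contract
redexStep-appˢ Q δ-redex             = δ-redex
redexStep-appˢ Q assoc-redex         = assoc-redex
redexStep-appˢ Q (γ-spine S₀ P e h)  = γ-spine (appˢ S₀ Q) P (cong suc e) (λ X → cong₂ app (h X) refl)
redexStep-appˢ Q (inSpine S* τ u h)  = inSpine (appˢ S* Q) τ u (λ H → ξapl (h H))

-- The spine steps.  Each rule fired at the spine is exhibited as a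
-- substitution τ acting uniformly on the hole.

var∘ : (ℕ → ℕ) → ℕ → Tm
var∘ ρ n = var (ρ n)

inSpine-arg : ∀ {k} (S : Spine k) P P' M N → P ⟶ P' →
  RedexStep (appˢ S P) M N (app (plug S (app (lam M) N)) P')
inSpine-arg S P P' M N s =
  redexStep-≡ (inSpine (appˢ S P') var (λ _ → refl) step) (cong (λ X → app (plug S X) P') (subst-id (λ _ → refl) _))
  where
  step : ∀ H → plug (appˢ S P) H ⟶ plug (appˢ S P') (subst var H)
  step H = ξapr s ⟶⟨ cong (λ X → app (plug S X) P') (sym (subst-id (λ _ → refl) H)) ⟩

inSpine-β : ∀ {k} (S : Spine k) P M N →
  RedexStep (appˢ (lamˢ S) P) M N (plug S (app (lam M) N) [ P ])
inSpine-β {k} S P M N =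
  redexStep-≡ (inSpine (substˢ (subst0 P) S) τ (uniform-spine k {1} {0} (λ _ → refl)) step)
              (sym (subst-plug (subst0 P) S _))
  where
  τ : ℕ → Tm
  τ = exts^ k (subst0 P)
  step : ∀ H → plug (appˢ (lamˢ S) P) H ⟶ plug (substˢ (subst0 P) S) (subst τ H)
  step H = top (β _ _) ⟶⟨ subst-plug (subst0 P) S H ⟩

inSpine-δ : ∀ {k} (S : Spine k) P M N →
  RedexStep (appˢ (lamˢ (lamˢ S)) P) M N (lam (app (lam (rename swap01 (plug S (app (lam M) N)))) (shift P)))
inSpine-δ {k} S P M N =
  redexStep-≡ (inSpine S* τ (uniform-spine k {2} {2} (λ _ → refl)) step)
              (cong (λ X → lam (app (lam X) (shift P))) (sym (swap-plug _)))
  where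
  S* : Spine (suc (suc k))
  S* = lamˢ (appˢ (lamˢ (substˢ (var∘ swap01) S)) (shift P))
  τ : ℕ → Tm
  τ = exts^ k (var∘ swap01)
  swap-plug : ∀ H → rename swap01 (plug S H) ≡ plug (substˢ (var∘ swap01) S) (subst τ H)
  swap-plug H = trans (rename-as-subst swap01 (plug S H)) (subst-plug (var∘ swap01) S H)
  step : ∀ H → plug (appˢ (lamˢ (lamˢ S)) P) H ⟶ plug S* (subst τ H)
  step H = top (δ _ _) ⟶⟨ cong (λ X → lam (app (lam X) (shift P))) (swap-plug H) ⟩

inSpine-γ : ∀ {k} (S : Spine k) Q P M N →
  RedexStep (appˢ (appˢ (lamˢ S) Q) P) M N (app (lam (app (plug S (app (lam M) N)) (shift P))) Q)
inSpine-γ {k} S Q P M N =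
  redexStep-≡ (inSpine S* var (λ _ → refl) step) (cong (λ X → app (lam (app (plug S X) (shift P))) Q) (subst-id (λ _ → refl) _))
  where
  S* : Spine (suc k)
  S* = appˢ (lamˢ (appˢ S (shift P))) Q
  step : ∀ H → plug (appˢ (appˢ (lamˢ S) Q) P) H ⟶ plug S* (subst var H)
  step H = top (γ _ _ _) ⟶⟨ cong (λ X → app (lam (app (plug S X) (shift P))) Q) (sym (subst-id (λ _ → refl) H)) ⟩

inSpine-assoc : ∀ {k} (S : Spine k) P₁ P₂ M N →
  RedexStep (appˢ S (app (lam P₁) P₂)) M N (app (lam (app (shift (plug S (app (lam M) N))) P₁)) P₂)
inSpine-assoc {k} S P₁ P₂ M N =
  redexStep-≡ (inSpine S* τ (uniform-spine k {0} {1} (λ _ → refl)) step)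
              (cong (λ X → app (lam (app X P₁)) P₂) (sym (shift-plug _)))
  where
  S* : Spine (suc k)
  S* = appˢ (lamˢ (appˢ (substˢ (var∘ suc) S) P₁)) P₂
  τ : ℕ → Tm
  τ = exts^ k (var∘ suc)
  shift-plug : ∀ H → shift (plug S H) ≡ plug (substˢ (var∘ suc) S) (subst τ H)
  shift-plug H = trans (rename-as-subst suc (plug S H)) (subst-plug (var∘ suc) S H)
  step : ∀ H → plug (appˢ S (app (lam P₁) P₂)) H ⟶ plug S* (subst τ H)
  step H = top (assoc _ _ _) ⟶⟨ cong (λ X → app (lam (app X P₁)) P₂) (shift-plug H) ⟩

redexStep : ∀ {k} (S : Spine k) M N {u} → plug S (app (lam M) N) ⟶ u → RedexStep S M N u
redexStep hole       M         N                 (top (β _ _))         = contract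
redexStep hole       (lam M)   N                 (top (δ _ _))         = δ-redex
redexStep hole       M         (app (lam N₁) N₂) (top (assoc _ _ _))   = assoc-redex
redexStep hole       M         N                 (ξapl (ξlam s))       = inBody s
redexStep hole       M         N                 (ξapr s)              = inArg s
redexStep (lamˢ S)   M         N                 (ξlam s)              = redexStep-lamˢ (redexStep S M N s)
redexStep (appˢ S P) M         N                 (ξapl s)              = redexStep-appˢ P (redexStep S M N s)
redexStep (appˢ S P) M         N                 (ξapr s)              = inSpine-arg S P _ M N s
redexStep (appˢ S P) M         N                 (top r)               = atSpineHead S P M N r
  where
  atSpineHead : ∀ {k} (S : Spine k) P M N {u} → app (plug S (app (lam M) N)) P ▷ u → RedexStep (appˢ S P) M N u
  atSpineHead hole              P M N (γ _ _ _)       = γ-spine hole P refl (λ X → refl)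
  atSpineHead (lamˢ hole)       P M N (β _ _)         = inSpine-β hole P M N
  atSpineHead (lamˢ (lamˢ S))   P M N (β _ _)         = inSpine-β (lamˢ S) P M N
  atSpineHead (lamˢ (lamˢ S))   P M N (δ _ _)         = inSpine-δ S P M N
  atSpineHead (lamˢ (appˢ S Q)) P M N (β _ _)         = inSpine-β (appˢ S Q) P M N
  atSpineHead (appˢ (lamˢ S) Q) P M N (γ _ _ _)       = inSpine-γ S Q P M N
  atSpineHead S                 _ M N (assoc _ P₁ P₂) = inSpine-assoc S P₁ P₂ M N

size : Tm → ℕ
size (var n)   = 1
size (lam M)   = suc (size M)
size (app M N) = suc (size M + size N)

size-rename : ∀ ρ M → size (rename ρ M) ≡ size M
size-rename ρ (var n)   = refl
size-rename ρ (lam M)   = cong suc (size-rename (ext ρ) M)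
size-rename ρ (app M N) = cong suc (cong₂ _+_ (size-rename ρ M) (size-rename ρ N))

record RenamedRedex (ρ : ℕ → ℕ) (N N₁ N₂ : Tm) : Set where
  constructor renamedRedex
  field
    {N₁' N₂'} : Tm
    is-redex  : N ≡ app (lam N₁') N₂'
    body      : N₁ ≡ rename (ext ρ) N₁'
    arg       : N₂ ≡ rename ρ N₂'

rename-redex⁻¹ : ∀ ρ N {N₁ N₂} → rename ρ N ≡ app (lam N₁) N₂ → RenamedRedex ρ N N₁ N₂
rename-redex⁻¹ ρ (app (lam N₁) N₂) refl = renamedRedex refl refl refl
rename-redex⁻¹ ρ (var _)           ()
rename-redex⁻¹ ρ (lam _)           ()
rename-redex⁻¹ ρ (app (var _) _)   ()
rename-redex⁻¹ ρ (app (app _ _) _) ()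

-- The argument N lives outside the spine, hence appears as wk k N.  Proof by
-- lexicographic induction on N (for ≺), on the contractum S[M[N]] (for
-- reduction), on the number of spine arguments and on the size of M: each
-- class of steps out of S[(λM) N] is handled by one clause of
-- expansion-step.

mutual
  expansion : ∀ {N} → Acc _≺_ N → ∀ {x} → SN x → ∀ {a m} → Acc _<_ a → Acc _<_ m →
    ∀ {k} (S : Spine k) M → x ≡ plug S (M [ wk k N ]) → #args S ≡ a → size M ≡ m →
    SN (plug S (app (lam M) (wk k N)))
  expansion accN snx acca accm S M eq ea em =
    acc λ step → expansion-step accN snx acca accm S M refl eq ea em (redexStep S M _ step)

  expansion-step : ∀ {N} → Acc _≺_ N → ∀ {x} → SN x → ∀ {a m} → Acc _<_ a → Acc _<_ m →
    ∀ {k} (S : Spine k) M {N'} → N' ≡ wk k N → x ≡ plug S (M [ N' ]) → #args S ≡ a → size M ≡ m →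
    ∀ {u} → RedexStep S M N' u → SN u
  expansion-step accN snx _ _ S M eN eq _ _ assoc-redex = expansion-assoc accN snx S M eN eq
  -- a step in the body M is also a step of the contractum x
  expansion-step accN (acc snx) _ _ S M refl eq _ _ (inBody s) =
    expansion accN (snx (≡-⟶ eq (plug-⟶ S (subst-⟶ _ s)))) (<-wellFounded _) (<-wellFounded _) S _ refl refl refl
  -- a step in the argument is a step of N, and makes x reduce in zero or more steps
  expansion-step {N} (acc accN) {x} snx _ _ {k} S M refl eq _ _ (inArg s) with reflect-⟶ (k +_) N s
  ... | reflected s₀ refl =
    expansion (accN (inj₁ s₀)) (SN-⟶* reduces snx) (<-wellFounded _) (<-wellFounded _) S M refl refl refl
    where
    reduces : x ⟶* plug S (M [ wk k _ ])
    reduces = transport (_⟶* _) (sym eq) (plug-⟶* S ([]-⟶* s M))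
  expansion-step accN snx _ _ S M refl eq _ _ contract = transport SN eq snx
  expansion-step accN snx acca accm S (lam M₁) refl eq ea em δ-redex = expansion-δ accN snx acca accm S M₁ eq ea em
  -- γ pulls a spine argument into the body: same contractum, one argument fewer
  expansion-step {N} accN {x} snx (acc acca) _ {k} S M refl eq ea _ (γ-spine S₀ P e h) =
    expansion accN snx (acca fewer) (<-wellFounded _) S₀ (app M (shift P)) eq' refl refl
    where
    fewer : #args S₀ < _
    fewer = transport (#args S₀ <_) (trans e ea) ≤-refl
    eq' : x ≡ plug S₀ (app M (shift P) [ wk k N ])
    eq' = trans eq (trans (h _) (cong (λ X → plug S₀ (app _ X)) (sym (shift-[] _ P))))
  -- a spine step is simulated by a step of the contractum x
  expansion-step {N} accN {x} (acc snx) _ _ {k} S M refl eq _ _ (inSpine {k* = k*} S* τ u h) =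
    transport SN (cong (λ X → plug S* (app (lam (subst (exts τ) M)) X)) (sym (subst-wk u N)))
      (expansion accN (snx (≡-⟶ eq (h _))) (<-wellFounded _) (<-wellFounded _) S* (subst (exts τ) M) eq' refl refl)
    where
    eq' : plug S* (subst τ (M [ wk k N ])) ≡ plug S* (subst (exts τ) M [ wk k* N ])
    eq' = cong (plug S*) (trans (subst-[] τ M _) (cong (subst (exts τ) M [_]) (subst-wk u N)))

  -- δ at the redex, (λλM₁) N ⟶ λ((λM₁') N↑): the new redex sits one binder
  -- deeper in the spine and has the smaller body M₁' (M₁ with its two
  -- innermost variables exchanged).
  expansion-δ : ∀ {N} → Acc _≺_ N → ∀ {x} → SN x → ∀ {a m} → Acc _<_ a → Acc _<_ m →
    ∀ {k} (S : Spine k) M₁ → x ≡ plug S (lam M₁ [ wk k N ]) → #args S ≡ a → size (lam M₁) ≡ m →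
    SN (plug S (lam (app (lam (rename swap01 M₁)) (shift (wk k N)))))
  expansion-δ {N} accN {x} snx acca (acc accm) {k} S M₁ eq ea em =
    transport SN plugged
      (expansion accN snx acca (accm smaller) (lamᴴ S) (rename swap01 M₁) eq' (trans (#args-lamᴴ S) ea) refl)
    where
    smaller : size (rename swap01 M₁) < _
    smaller = transport (_< _) (sym (size-rename swap01 M₁)) (transport (size M₁ <_) em ≤-refl)
    open ≡-Reasoning
    eq' : x ≡ plug (lamᴴ S) (rename swap01 M₁ [ wk (suc k) N ])
    eq' = begin
      x                                                  ≡⟨ eq ⟩
      plug S (lam (subst (exts (subst0 (wk k N))) M₁))   ≡⟨ cong (λ X → plug S (lam X)) (sym (swap-[] (wk k N) M₁)) ⟩
      plug S (lam (rename swap01 M₁ [ shift (wk k N) ])) ≡⟨ cong (λ X → plug S (lam (rename swap01 M₁ [ X ]))) (shift-wk k N) ⟩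
      plug S (lam (rename swap01 M₁ [ wk (suc k) N ]))   ≡⟨ sym (plug-lamᴴ S _) ⟩
      plug (lamᴴ S) (rename swap01 M₁ [ wk (suc k) N ])  ∎
    plugged : plug (lamᴴ S) (app (lam (rename swap01 M₁)) (wk (suc k) N))
            ≡ plug S (lam (app (lam (rename swap01 M₁)) (shift (wk k N))))
    plugged = trans (plug-lamᴴ S _) (cong (λ X → plug S (lam (app (lam (rename swap01 M₁)) X))) (sym (shift-wk k N)))

  -- assoc at the redex, (λM) ((λN₁) N₂) ⟶ (λ(λM)↑ N₁) N₂: first the inner
  -- redex (λN₁) N₂ is contracted (N reduces), then the outer one is expanded
  -- (N₂ is a subterm of N).
  expansion-assoc : ∀ {N} → Acc _≺_ N → ∀ {x} → SN x → ∀ {k} (S : Spine k) M {N₁ N₂} →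
    app (lam N₁) N₂ ≡ wk k N → x ≡ plug S (M [ app (lam N₁) N₂ ]) →
    SN (plug S (app (lam (app (shift (lam M)) N₁)) N₂))
  expansion-assoc {N} (acc accN) {x} snx {k} S M eN eq with rename-redex⁻¹ (k +_) N (sym eN)
  ... | renamedRedex {N₁} {N₂} refl refl refl =
    expansion (accN (inj₂ argˢ)) inner (<-wellFounded _) (<-wellFounded _) S M* outer-eq refl refl
    where
    contracts : app (lam N₁) N₂ ⟶ (N₁ [ N₂ ])
    contracts = top (β N₁ N₂)
    inner : SN (plug S (app (lam M) (wk k (N₁ [ N₂ ]))))
    inner = expansion (accN (inj₁ contracts))
              (SN-⟶* (transport (_⟶* _) (sym eq) (plug-⟶* S ([]-⟶* (rename-⟶ (k +_) contracts) M))) snx)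
              (<-wellFounded _) (<-wellFounded _) S M refl refl refl
    M* : Tm
    M* = app (shift (lam M)) (rename (ext (k +_)) N₁)
    outer-eq : plug S (app (lam M) (wk k (N₁ [ N₂ ]))) ≡ plug S (M* [ wk k N₂ ])
    outer-eq = cong (plug S) (cong₂ app (sym (shift-[] (wk k N₂) (lam M))) (rename-[] (k +_) N₁ N₂))

-- Applications  h P₁ … Pₙ ; the list holds the arguments last one first.

apps : Tm → List Tm → Tm
apps h []       = h
apps h (P ∷ Ps) = app (apps h Ps) P

apps-++ : ∀ h Ps Qs → apps h (Ps ++ Qs) ≡ apps (apps h Qs) Ps
apps-++ h []       Qs = refl
apps-++ h (P ∷ Ps) Qs = cong₂ app (apps-++ h Ps Qs) refl

argsˢ : List Tm → Spine 0
argsˢ []       = hole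
argsˢ (P ∷ Ps) = appˢ (argsˢ Ps) P

plug-argsˢ : ∀ Ps H → plug (argsˢ Ps) H ≡ apps H Ps
plug-argsˢ []       H = refl
plug-argsˢ (P ∷ Ps) H = cong₂ app (plug-argsˢ Ps H) refl

head-expansion : ∀ M N Ps → SN N → SN (apps (M [ N ]) Ps) → SN (apps (app (lam M) N) Ps)
head-expansion M N Ps snN sn =
  transport SN (trans (plug-argsˢ Ps _) (cong (λ X → apps (app (lam M) X) Ps) (wk-zero N)))
    (expansion (SN⇒Acc≺ snN) sn (<-wellFounded _) (<-wellFounded _) (argsˢ Ps) M contractum refl refl)
  where
  contractum : apps (M [ N ]) Ps ≡ plug (argsˢ Ps) (M [ wk 0 N ])
  contractum = sym (trans (plug-argsˢ Ps _) (cong (λ X → apps (M [ X ]) Ps) (wk-zero N)))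

infix 4 _⟶ᴸ_
data _⟶ᴸ_ : List Tm → List Tm → Set where
  here  : ∀ {P P' Ps} → P ⟶ P' → (P ∷ Ps) ⟶ᴸ (P' ∷ Ps)
  there : ∀ {P Ps Ps'} → Ps ⟶ᴸ Ps' → (P ∷ Ps) ⟶ᴸ (P ∷ Ps')

AllSN⇒Acc : ∀ {Ps} → All SN Ps → Acc (λ Qs Ps → Ps ⟶ᴸ Qs) Ps
AllSN⇒Acc []         = acc λ ()
AllSN⇒Acc (sn ∷ sns) = cons sn (AllSN⇒Acc sns)
  where
  cons : ∀ {P Ps} → SN P → Acc (λ Qs Ps → Ps ⟶ᴸ Qs) Ps → Acc (λ Qs Ps → Ps ⟶ᴸ Qs) (P ∷ Ps)
  cons (acc snP) (acc accPs) = acc λ where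
    (here s)  → cons (snP s) (acc accPs)
    (there l) → cons (acc snP) (accPs l)

AllSN-⟶ᴸ : ∀ {Ps Ps'} → Ps ⟶ᴸ Ps' → All SN Ps → All SN Ps'
AllSN-⟶ᴸ (here s)  (acc sn ∷ sns) = sn s ∷ sns
AllSN-⟶ᴸ (there l) (sn ∷ sns)     = sn ∷ AllSN-⟶ᴸ l sns

data NeutralStep (x : ℕ) (Ps : List Tm) : Tm → Set where
  inArgs    : ∀ {Ps'} → Ps ⟶ᴸ Ps' → NeutralStep x Ps (apps (var x) Ps')
  assoc-arg : ∀ Ps₂ Q₁ Q₂ Ps₁ → Ps ≡ Ps₂ ++ (app (lam Q₁) Q₂ ∷ Ps₁) →
    NeutralStep x Ps (apps (app (lam (app (shift (apps (var x) Ps₁)) Q₁)) Q₂) Ps₂)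

neutralStep : ∀ x Ps {u} → apps (var x) Ps ⟶ u → NeutralStep x Ps u
neutralStep x []                (top ())
-- assoc is the only rule firing at the head of a neutral term; splitting off
-- three arguments exposes enough of the term for the other rules to be refuted
neutralStep x (P ∷ Q ∷ Q' ∷ Qs) (top (assoc _ Q₁ Q₂)) = assoc-arg [] Q₁ Q₂ (Q ∷ Q' ∷ Qs) refl
neutralStep x (P ∷ Ps)          (top (assoc _ Q₁ Q₂)) = assoc-arg [] Q₁ Q₂ Ps refl
neutralStep x (P ∷ Ps)          (ξapr s)              = inArgs (here s)
neutralStep x (P ∷ Ps)          (ξapl s) with neutralStep x Ps s
... | inArgs l                  = inArgs (there l)
... | assoc-arg Ps₂ Q₁ Q₂ Ps₁ e = assoc-arg (P ∷ Ps₂) Q₁ Q₂ Ps₁ (cong (P ∷_) e)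

allSN-middle : ∀ Ps₂ {Q Ps₁} → All SN (Ps₂ ++ (Q ∷ Ps₁)) → SN Q
allSN-middle []        (sn ∷ _)   = sn
allSN-middle (_ ∷ Ps₂) (_ ∷ sns)  = allSN-middle Ps₂ sns

⟶ᴸ-middle : ∀ Ps₂ {Q Q' Ps₁} → Q ⟶ Q' → (Ps₂ ++ (Q ∷ Ps₁)) ⟶ᴸ (Ps₂ ++ (Q' ∷ Ps₁))
⟶ᴸ-middle []        s = here s
⟶ᴸ-middle (_ ∷ Ps₂) s = there (⟶ᴸ-middle Ps₂ s)

-- By induction on the argument list; the assoc case is a head expansion of
-- the term in which the argument redex (λQ₁) Q₂ has been contracted.
neutral-SN : ∀ x {Ps} → Acc (λ Qs Ps → Ps ⟶ᴸ Qs) Ps → All SN Ps → SN (apps (var x) Ps)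
neutral-SN x {Ps} (acc accPs) sns = acc λ step → reduct-SN (neutralStep x Ps step)
  where
  reduct-SN : ∀ {u} → NeutralStep x Ps u → SN u
  reduct-SN (inArgs l) = neutral-SN x (accPs l) (AllSN-⟶ᴸ l sns)
  reduct-SN (assoc-arg Ps₂ Q₁ Q₂ Ps₁ refl) =
    head-expansion M* Q₂ Ps₂ (SN-appʳ (allSN-middle Ps₂ sns)) (transport SN contracted ih)
    where
    M* : Tm
    M* = app (shift (apps (var x) Ps₁)) Q₁
    l : (Ps₂ ++ (app (lam Q₁) Q₂ ∷ Ps₁)) ⟶ᴸ (Ps₂ ++ ((Q₁ [ Q₂ ]) ∷ Ps₁))
    l = ⟶ᴸ-middle Ps₂ (top (β Q₁ Q₂))
    ih : SN (apps (var x) (Ps₂ ++ ((Q₁ [ Q₂ ]) ∷ Ps₁)))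
    ih = neutral-SN x (accPs l) (AllSN-⟶ᴸ l sns)
    contracted : apps (var x) (Ps₂ ++ ((Q₁ [ Q₂ ]) ∷ Ps₁)) ≡ apps (M* [ Q₂ ]) Ps₂
    contracted = trans (apps-++ (var x) Ps₂ _)
                       (cong (λ X → apps (app X (Q₁ [ Q₂ ])) Ps₂) (sym (shift-[] Q₂ (apps (var x) Ps₁))))

module Reducibility (Atom : Set) where
  open SystemD Atom

  mutual
    ⟦_⟧ˢ : SType → Tm → Set
    ⟦ atom _ ⟧ˢ t = SN t
    ⟦ A ⇒ B ⟧ˢ t = ∀ u → ⟦ A ⟧ u → ⟦ B ⟧ˢ (app t u)

    ⟦_⟧ : Ty → Tm → Set
    ⟦ simple S ⟧ t = ⟦ S ⟧ˢ t
    ⟦ S ∧ T ⟧ t    = ⟦ S ⟧ˢ t × ⟦ T ⟧ t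

  -- Reducible terms are SN, and neutral terms with SN arguments are
  -- reducible (the two facts are proved together: SN of a reducible
  -- function follows from applying it to the reducible variable 0).
  mutual
    reducibleˢ⇒SN : ∀ S {t} → ⟦ S ⟧ˢ t → SN t
    reducibleˢ⇒SN (atom _) r = r
    reducibleˢ⇒SN (A ⇒ B)  r = SN-appˡ (reducibleˢ⇒SN B (r (var 0) (neutral-reducible A 0 [] [])))

    reducible⇒SN : ∀ T {t} → ⟦ T ⟧ t → SN t
    reducible⇒SN (simple S) r       = reducibleˢ⇒SN S r
    reducible⇒SN (S ∧ T)    (r , _) = reducibleˢ⇒SN S r

    neutral-reducibleˢ : ∀ S x Ps → All SN Ps → ⟦ S ⟧ˢ (apps (var x) Ps)
    neutral-reducibleˢ (atom _) x Ps sns = neutral-SN x (AllSN⇒Acc sns) sns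
    neutral-reducibleˢ (A ⇒ B)  x Ps sns = λ u r → neutral-reducibleˢ B x (u ∷ Ps) (reducible⇒SN A r ∷ sns)

    neutral-reducible : ∀ T x Ps → All SN Ps → ⟦ T ⟧ (apps (var x) Ps)
    neutral-reducible (simple S) x Ps sns = neutral-reducibleˢ S x Ps sns
    neutral-reducible (S ∧ T)    x Ps sns = neutral-reducibleˢ S x Ps sns , neutral-reducible T x Ps sns

  expansion-reducibleˢ : ∀ S {M N} Ps → SN N → ⟦ S ⟧ˢ (apps (M [ N ]) Ps) → ⟦ S ⟧ˢ (apps (app (lam M) N) Ps)
  expansion-reducibleˢ (atom _) Ps snN r = head-expansion _ _ Ps snN r
  expansion-reducibleˢ (A ⇒ B)  Ps snN r = λ u ru → expansion-reducibleˢ B (u ∷ Ps) snN (r u ru)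

  Reducible : Ctx → (ℕ → Tm) → Set
  Reducible Γ σ = ∀ {n A} → Γ ∋ n ⦂ A → ⟦ A ⟧ (σ n)

  adequacy : ∀ {Γ M A} → Γ ⊢ M ⦂ A → ∀ σ → Reducible Γ σ → ⟦ A ⟧ (subst σ M)
  adequacy (ax x)    σ rσ = rσ x
  adequacy (→E d e)  σ rσ = adequacy d σ rσ _ (adequacy e σ rσ)
  adequacy (→I {M = M} {A = A} {B = B} d) σ rσ = λ u ru →
    expansion-reducibleˢ B [] (reducible⇒SN A ru)
      (transport ⟦ simple B ⟧ (sym (exts-[] u σ M)) (adequacy d (u · σ) (extend ru)))
    where
    extend : ∀ {u} → ⟦ A ⟧ u → Reducible (A ∷ _) (u · σ)
    extend ru here      = ru
    extend ru (there x) = rσ x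
  adequacy (∧E₁ d)   σ rσ = proj₁ (adequacy d σ rσ)
  adequacy (∧E₂ d)   σ rσ = proj₂ (adequacy d σ rσ)
  adequacy (∧I d e)  σ rσ = adequacy d σ rσ , adequacy e σ rσ

  identity-reducible : ∀ Γ → Reducible Γ var
  identity-reducible Γ {n} {A} _ = neutral-reducible A n [] []

corollary3p1 : (Atom : Set) (t : Tm) → SystemD.Typable Atom t → SN t
corollary3p1 Atom t (Γ , A , d) =
  reducible⇒SN A (transport ⟦ A ⟧ (subst-id (λ _ → refl) t) (adequacy d var (identity-reducible Γ)))
  where open Reducibility Atom
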